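{- Let $n\ge1$ and $d\ge 0$. If there exists a Gray code $F:\{0,1\}^n\to\{0,1\}^n$ of degree at most $d$, then $d\ge\log_2 n$.
   Context: An automata network is a map $F:\{0,1\}^V\to\{0,1\}^V$, $V=\{1,\dots,n\}$, with local functions $f_j(x)=F(x)_j$. Its interaction graph has an arc $(i,j)$ iff $f_j$ effectively depends on $x_i$ (there exist $x,x'$ differing only at $i$ with $f_j(x)\neq f_j(x')$). The degree of $F$ is the maximum in-degree of its interaction graph. A Gray code is a map $F$ whose functional graph is a single cycle of length $2^n$ and such that, for every $x$, $x$ and $F(x)$ differ in exactly one component. -}

module Defs where

open import Data.Nat using (ℕ; _≤_; _^_)
open import Data.Bool using (Bool; not; true; false; _∧_; _∨_)
open import Data.Fin using (Fin)
open import Data.Vec using (Vec; []; _∷_; lookup; updateAt; allFin; map; toList)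
open import Data.List using (List; length; filter; concatMap; [_])
open import Data.Bool.ListAction using (any)
import Data.List as L
open import Data.Bool.Properties using () renaming (_≟_ to _≟ᵇ_)
open import Data.Product using (∃; Σ; _×_)
open import Relation.Binary.PropositionalEquality using (_≡_)
open import Relation.Nullary using (¬_; does)
open import Function using (_∘_)

-- Configurations {0,1}^n, with 0/1 encoded as false/true.
Config : ℕ → Set
Config n = Vec Bool n

AN : ℕ → Set
AN n = Config n → Config n

flip : ∀ {n} → Config n → Fin n → Config n
flip x i = updateAt x i not

allConfigs : (n : ℕ) → List (Config n)
allConfigs ℕ.zero = [ [] ]
allConfigs (ℕ.suc n) = concatMap (λ x → (false ∷ x) L.∷ L.[ true ∷ x ]) (allConfigs n)

-- f_j effectively depends on x_i (boolean test by exhaustive search over configurations):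
-- there is x such that f_j(x) ≠ f_j(x with i flipped).
dependsᵇ : ∀ {n} → AN n → Fin n → Fin n → Bool
dependsᵇ {n} F i j = any (λ x → not (does (lookup (F x) j ≟ᵇ lookup (F (flip x i)) j))) (allConfigs n)

inDegree : ∀ {n} → AN n → Fin n → ℕ
inDegree {n} F j = length (filter (λ i → dependsᵇ F i j ≟ᵇ true) (toList (allFin n)))

DegreeAtMost : ∀ {n} → AN n → ℕ → Set
DegreeAtMost {n} F d = ∀ (j : Fin n) → inDegree F j ≤ d

iter : ∀ {A : Set} → (A → A) → ℕ → A → A
iter f ℕ.zero x = x
iter f (ℕ.suc k) x = f (iter f k x)

-- Gray code: the functional graph is a single cycle (of length 2^n, i.e. through all
-- configurations: every configuration is reached from every other one by iterating F),
-- and each step changes exactly one component.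
IsGrayCode : ∀ {n} → AN n → Set
IsGrayCode {n} F =
  (∀ (x y : Config n) → ∃ λ k → iter F k x ≡ y) ×
  (∀ (x : Config n) → ∃ λ (i : Fin n) → F x ≡ flip x i)

-- For each coordinate j let g_j(x) = x_j ⊕ f_j(x), which marks the configurations where F flips
-- component j. Since every step flips exactly one component, Σ_j |g_j⁻¹(1)| = 2^n. Each g_j is
-- nonzero somewhere, as the cycle has to flip component j at least once. If j is an in-neighbour of
-- itself, g_j only depends on the at most d in-neighbours of j, so it takes the value 1 on at least
-- 2^(n-d) configurations; otherwise flipping x_j flips g_j, so g_j takes the value 1 on exactly
-- 2^(n-1) ≥ 2^(n-d) configurations as soon as d ≥ 1. Summing over j gives n 2^(n-d) ≤ 2^n.
-- Degree 0 is impossible: F would be constant, and its value would be a fixed point.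
module Submission where

open import Defs
open import Data.Nat using (ℕ; _≤_; _^_; NonZero)
open import Data.Product using (∃; _×_)
open import Algebra.Properties.CommutativeSemigroup using (interchange)
open import Data.Bool using (Bool; true; false; not; _xor_; T)
open import Data.Bool.ListAction using (any)
open import Data.Bool.Properties using (xor-same; xor-inverseʳ; not-distribˡ-xor; not-¬; ¬-not)
  renaming (_≟_ to _≟ᵇ_)
open import Data.Fin using (Fin; zero; suc)
open import Data.Fin.Subset using (Subset; inside; outside; _∈_; _∉_; ∣_∣)
open import Data.Fin.Subset.Properties using (_∈?_; drop-there; x∈⁅y⁆⇒x≡y; ∣⁅x⁆∣≡1; p⊆q⇒∣p∣≤∣q∣)
open import Data.List using (length; filter)
import Data.List as List
open import Data.List.Membership.Propositional using (lose) renaming (_∈_ to _∈ₗ_)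
open import Data.List.Membership.Propositional.Properties using (∈-concatMap⁺)
open import Data.List.Relation.Unary.Any using (here; there; satisfied)
open import Data.List.Relation.Unary.Any.Properties using (any⁺; any⁻)
open import Data.Nat using (zero; suc; _+_; _*_; z≤n)
open import Data.Nat.Properties
  using (+-*-semiring; +-commutativeSemigroup; +-identityʳ; *-identityʳ; *-assoc; *-distribˡ-+;
         *-distribʳ-+; +-mono-≤; *-monoʳ-≤; *-monoˡ-≤; ≤-refl; ≤-trans; m≤m+n; m≤n+m; *-cancelʳ-≤;
         m^n≢0; m^n>0; ^-monoʳ-≤; module ≤-Reasoning)
open import Data.Product using (_,_; proj₁; proj₂)
open import Data.Sum using (_⊎_; inj₁; inj₂)
open import Data.Vec using (Vec; []; _∷_; lookup; map; allFin; toList; replicate; here; there)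
open import Data.Vec.Properties using (lookup∘updateAt; lookup-map; lookup-allFin; lookup⇒[]=)
open import Function using (_∘_)
open import Relation.Binary.PropositionalEquality
  using (_≡_; refl; sym; trans; cong; cong₂; subst; module ≡-Reasoning)
open import Relation.Nullary using (¬_; does; yes; no; contradiction)
open import Relation.Nullary.Decidable using (T?)
open import Algebra.Properties.Semiring.Sum +-*-semiring using (sum-syntax; ∑-distrib-+; *-distribˡ-sum)

private
  variable
    n : ℕ
    p : Subset n
    x y : Config n

∑-const : ∀ n c → ∑[ j < n ] c ≡ n * c
∑-const zero c = refl
∑-const (suc n) c = cong (c +_) (∑-const n c)

∑-mono-≤ : ∀ {n} {f g : Fin n → ℕ} → (∀ j → f j ≤ g j) → ∑[ j < n ] f j ≤ ∑[ j < n ] g j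
∑-mono-≤ {zero} f≤g = z≤n
∑-mono-≤ {suc n} f≤g = +-mono-≤ (f≤g zero) (∑-mono-≤ (f≤g ∘ suc))

∈-allConfigs : (x : Config n) → x ∈ₗ allConfigs n
∈-allConfigs [] = here refl
∈-allConfigs (b ∷ x) = ∈-concatMap⁺ _ (lose (∈-allConfigs x) (∷-∈ b))
  where
  ∷-∈ : ∀ b → (b ∷ x) ∈ₗ ((false ∷ x) List.∷ List.[ true ∷ x ])
  ∷-∈ false = here refl
  ∷-∈ true = there (here refl)

¬T-any-allConfigs : ∀ (P : Config n → Bool) → ¬ T (any P (allConfigs n)) → ∀ x → ¬ T (P x)
¬T-any-allConfigs P none x Px = none (any⁺ P (lose (∈-allConfigs x) Px))

finite-search : ∀ (P : Config n → Bool) → (∃ λ x → T (P x)) ⊎ (∀ x → ¬ T (P x))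
finite-search {n} P with T? (any P (allConfigs n))
... | yes some = inj₁ (satisfied (any⁻ P (allConfigs n) some))
... | no none = inj₂ (¬T-any-allConfigs P none)

sumConfigs : (Config n → ℕ) → ℕ
sumConfigs {zero} f = f []
sumConfigs {suc n} f = sumConfigs (f ∘ (false ∷_)) + sumConfigs (f ∘ (true ∷_))

sumConfigs-cong : ∀ {f g : Config n → ℕ} → (∀ x → f x ≡ g x) → sumConfigs f ≡ sumConfigs g
sumConfigs-cong {zero} f≗g = f≗g []
sumConfigs-cong {suc n} f≗g = cong₂ _+_ (sumConfigs-cong (f≗g ∘ (false ∷_))) (sumConfigs-cong (f≗g ∘ (true ∷_)))

sumConfigs-const : ∀ n c → sumConfigs {n} (λ _ → c) ≡ 2 ^ n * c
sumConfigs-const zero c = sym (+-identityʳ c)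
sumConfigs-const (suc n) c = begin
  sumConfigs {n} (λ _ → c) + sumConfigs {n} (λ _ → c)  ≡⟨ cong₂ _+_ (sumConfigs-const n c) (sumConfigs-const n c) ⟩
  2 ^ n * c + 2 ^ n * c                                 ≡⟨ *-distribʳ-+ c (2 ^ n) (2 ^ n) ⟨
  (2 ^ n + 2 ^ n) * c                                   ≡⟨ cong (λ m → (2 ^ n + m) * c) (+-identityʳ (2 ^ n)) ⟨
  2 ^ suc n * c                                         ∎
  where open ≡-Reasoning

sumConfigs-+ : ∀ (f g : Config n → ℕ) → sumConfigs (λ x → f x + g x) ≡ sumConfigs f + sumConfigs g
sumConfigs-+ {zero} f g = refl
sumConfigs-+ {suc n} f g = trans
  (cong₂ _+_ (sumConfigs-+ (f ∘ (false ∷_)) (g ∘ (false ∷_))) (sumConfigs-+ (f ∘ (true ∷_)) (g ∘ (true ∷_))))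
  (interchange +-commutativeSemigroup (sumConfigs (f ∘ (false ∷_))) _ _ _)

sumConfigs-∑-comm : ∀ {m} (f : Fin m → Config n → ℕ) →
  sumConfigs (λ x → ∑[ j < m ] f j x) ≡ ∑[ j < m ] sumConfigs (f j)
sumConfigs-∑-comm {n = zero} f = refl
sumConfigs-∑-comm {n = suc n} f = trans
  (cong₂ _+_ (sumConfigs-∑-comm (λ j → f j ∘ (false ∷_))) (sumConfigs-∑-comm (λ j → f j ∘ (true ∷_))))
  (sym (∑-distrib-+ (λ j → sumConfigs (f j ∘ (false ∷_))) (λ j → sumConfigs (f j ∘ (true ∷_)))))

𝟙 : Bool → ℕ
𝟙 false = 0
𝟙 true = 1

count : (Config n → Bool) → ℕ
count P = sumConfigs (𝟙 ∘ P)

count-∷-≤ : ∀ (P : Config (suc n) → Bool) a → count (P ∘ (a ∷_)) ≤ count P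
count-∷-≤ P false = m≤m+n _ _
count-∷-≤ P true = m≤n+m _ _

T⇒1≤𝟙 : ∀ {b} → T b → 1 ≤ 𝟙 b
T⇒1≤𝟙 {true} _ = ≤-refl

𝟙-+-𝟙-not : ∀ b → 𝟙 b + 𝟙 (not b) ≡ 1
𝟙-+-𝟙-not false = refl
𝟙-+-𝟙-not true = refl

_≈[_]_ : Config n → Subset n → Config n → Set
x ≈[ p ] y = ∀ {i} → i ∈ p → lookup x i ≡ lookup y i

∷⁺-≈ : ∀ {s} a → x ≈[ p ] y → (a ∷ x) ≈[ s ∷ p ] (a ∷ y)
∷⁺-≈ a x≈y here = refl
∷⁺-≈ a x≈y (there i∈p) = x≈y i∈p

∷⁻-≈ : ∀ {s a b} → (a ∷ x) ≈[ s ∷ p ] (b ∷ y) → x ≈[ p ] y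
∷⁻-≈ ax≈by i∈p = ax≈by (there i∈p)

∈⇒1≤∣p∣ : ∀ {i} → i ∈ p → 1 ≤ ∣ p ∣
∈⇒1≤∣p∣ {p = p} {i} i∈p = subst (_≤ ∣ p ∣) (∣⁅x⁆∣≡1 i)
  (p⊆q⇒∣p∣≤∣q∣ λ k∈⁅i⁆ → subst (_∈ p) (sym (x∈⁅y⁆⇒x≡y i k∈⁅i⁆)) i∈p)

∣p∣≤0⇒≈ : ∣ p ∣ ≤ 0 → ∀ x y → x ≈[ p ] y
∣p∣≤0⇒≈ ∣p∣≤0 x y i∈p = contradiction (≤-trans (∈⇒1≤∣p∣ i∈p) ∣p∣≤0) λ ()

zero-flip-invariant⇒head-irrelevant : ∀ {A : Set} (g : Config (suc n) → A) →
  (∀ x → g (flip x zero) ≡ g x) → ∀ a b x → g (a ∷ x) ≡ g (b ∷ x)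
zero-flip-invariant⇒head-irrelevant g inv false false x = refl
zero-flip-invariant⇒head-irrelevant g inv true true x = refl
zero-flip-invariant⇒head-irrelevant g inv false true x = sym (inv (false ∷ x))
zero-flip-invariant⇒head-irrelevant g inv true false x = sym (inv (true ∷ x))

flip-invariant⇒respects-≈ : ∀ {A : Set} (g : Config n → A) →
  (∀ {i} x → i ∉ p → g (flip x i) ≡ g x) → x ≈[ p ] y → g x ≡ g y
flip-invariant⇒respects-≈ {p = []} {x = []} {y = []} g inv _ = refl
flip-invariant⇒respects-≈ {p = inside ∷ p} {x = a ∷ x} {y = b ∷ y} g inv ax≈by with ax≈by here
... | refl = flip-invariant⇒respects-≈ (g ∘ (a ∷_)) (λ z i∉p → inv (a ∷ z) (i∉p ∘ drop-there)) (∷⁻-≈ ax≈by)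
flip-invariant⇒respects-≈ {p = outside ∷ p} {x = a ∷ x} {y = b ∷ y} g inv ax≈by =
  trans (zero-flip-invariant⇒head-irrelevant g (λ z → inv z λ ()) a b x)
        (flip-invariant⇒respects-≈ (g ∘ (b ∷_)) (λ z i∉p → inv (b ∷ z) (i∉p ∘ drop-there)) (∷⁻-≈ ax≈by))

respects-≈⇒count-≥ : ∀ (P : Config n → Bool) → (∀ x y → x ≈[ p ] y → P x ≡ P y) →
  (∃ λ x → T (P x)) → 2 ^ n ≤ 2 ^ ∣ p ∣ * count P
respects-≈⇒count-≥ {p = []} P resp ([] , Px₀) = ≤-trans (T⇒1≤𝟙 Px₀) (m≤m+n _ 0)
respects-≈⇒count-≥ {suc n} {p = inside ∷ p} P resp (a ∷ x₀ , Px₀) = begin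
  2 * 2 ^ n                            ≤⟨ *-monoʳ-≤ 2 ih ⟩
  2 * (2 ^ ∣ p ∣ * count (P ∘ (a ∷_)))  ≤⟨ *-monoʳ-≤ 2 (*-monoʳ-≤ (2 ^ ∣ p ∣) (count-∷-≤ P a)) ⟩
  2 * (2 ^ ∣ p ∣ * count P)             ≡⟨ *-assoc 2 (2 ^ ∣ p ∣) (count P) ⟨
  2 ^ suc ∣ p ∣ * count P               ∎
  where
  open ≤-Reasoning
  ih = respects-≈⇒count-≥ (P ∘ (a ∷_)) (λ x y → resp (a ∷ x) (a ∷ y) ∘ ∷⁺-≈ a) (x₀ , Px₀)
respects-≈⇒count-≥ {suc n} {p = outside ∷ p} P resp (a ∷ x₀ , Px₀) = begin
  2 * 2 ^ n                      ≤⟨ *-monoʳ-≤ 2 ih ⟩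
  2 * (2 ^ ∣ p ∣ * c)             ≡⟨ cong (2 ^ ∣ p ∣ * c +_) (+-identityʳ (2 ^ ∣ p ∣ * c)) ⟩
  2 ^ ∣ p ∣ * c + 2 ^ ∣ p ∣ * c   ≡⟨ *-distribˡ-+ (2 ^ ∣ p ∣) c c ⟨
  2 ^ ∣ p ∣ * (c + c)             ≡⟨ cong (2 ^ ∣ p ∣ *_) (cong₂ _+_ (head-irrelevant false) (head-irrelevant true)) ⟩
  2 ^ ∣ p ∣ * count P             ∎
  where
  open ≤-Reasoning
  c = count (P ∘ (a ∷_))
  ih = respects-≈⇒count-≥ (P ∘ (a ∷_)) (λ x y → resp (a ∷ x) (a ∷ y) ∘ ∷⁺-≈ a) (x₀ , Px₀)
  head-irrelevant : ∀ b → c ≡ count (P ∘ (b ∷_))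
  head-irrelevant b = sumConfigs-cong λ z → cong 𝟙 (resp (a ∷ z) (b ∷ z) λ { (there _) → refl })

flip-negates⇒count-half : ∀ (P : Config n → Bool) j → (∀ x → P (flip x j) ≡ not (P x)) →
  2 * count P ≡ 2 ^ n
flip-negates⇒count-half {suc n} P zero negates = cong (2 *_) (begin
  count (P ∘ (false ∷_)) + count (P ∘ (true ∷_))            ≡⟨ sumConfigs-+ (𝟙 ∘ P ∘ (false ∷_)) _ ⟨
  sumConfigs (λ z → 𝟙 (P (false ∷ z)) + 𝟙 (P (true ∷ z)))  ≡⟨ sumConfigs-cong one ⟩
  sumConfigs {n} (λ _ → 1)                                  ≡⟨ sumConfigs-const n 1 ⟩
  2 ^ n * 1                                                 ≡⟨ *-identityʳ (2 ^ n) ⟩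
  2 ^ n                                                     ∎)
  where
  open ≡-Reasoning
  one : ∀ z → 𝟙 (P (false ∷ z)) + 𝟙 (P (true ∷ z)) ≡ 1
  one z = trans (cong (λ b → 𝟙 (P (false ∷ z)) + 𝟙 b) (negates (false ∷ z))) (𝟙-+-𝟙-not (P (false ∷ z)))
flip-negates⇒count-half {suc n} P (suc j) negates = begin
  2 * (count P₀ + count P₁)         ≡⟨ *-distribˡ-+ 2 (count P₀) (count P₁) ⟩
  2 * count P₀ + 2 * count P₁       ≡⟨ cong₂ _+_ (flip-negates⇒count-half P₀ j (negates ∘ (false ∷_)))
                                                 (flip-negates⇒count-half P₁ j (negates ∘ (true ∷_))) ⟩
  2 ^ n + 2 ^ n                     ≡⟨ cong (2 ^ n +_) (+-identityʳ (2 ^ n)) ⟨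
  2 ^ suc n                         ∎
  where
  open ≡-Reasoning
  P₀ = P ∘ (false ∷_)
  P₁ = P ∘ (true ∷_)

hamming : Config n → Config n → ℕ
hamming {n} x y = ∑[ j < n ] 𝟙 (lookup x j xor lookup y j)

hamming-refl : ∀ (x : Config n) → hamming x x ≡ 0
hamming-refl [] = refl
hamming-refl (a ∷ x) = cong₂ _+_ (cong 𝟙 (xor-same a)) (hamming-refl x)

hamming-flip : ∀ (x : Config n) i → hamming x (flip x i) ≡ 1
hamming-flip (a ∷ x) zero = cong₂ _+_ (cong 𝟙 (xor-inverseʳ a)) (hamming-refl x)
hamming-flip (a ∷ x) (suc i) = cong₂ _+_ (cong 𝟙 (xor-same a)) (hamming-flip x i)

iter-preserves : ∀ {A B : Set} (f : A → A) (h : A → B) → (∀ a → h (f a) ≡ h a) →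
  ∀ k a → h (iter f k a) ≡ h a
iter-preserves f h preserves zero a = refl
iter-preserves f h preserves (suc k) a = trans (preserves (iter f k a)) (iter-preserves f h preserves k a)

¬T-xor⇒≡ : ∀ a b → ¬ T (a xor b) → a ≡ b
¬T-xor⇒≡ false false _ = refl
¬T-xor⇒≡ true true _ = refl
¬T-xor⇒≡ false true ¬t = contradiction _ ¬t
¬T-xor⇒≡ true false ¬t = contradiction _ ¬t

¬T-not-≟⇒≡ : ∀ a b → ¬ T (not (does (a ≟ᵇ b))) → a ≡ b
¬T-not-≟⇒≡ false false _ = refl
¬T-not-≟⇒≡ true true _ = refl
¬T-not-≟⇒≡ false true ¬t = contradiction _ ¬t
¬T-not-≟⇒≡ true false ¬t = contradiction _ ¬t

¬dependsᵇ⇒flip-invariant : ∀ (F : AN n) i j → dependsᵇ F i j ≡ false →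
  ∀ x → lookup (F (flip x i)) j ≡ lookup (F x) j
¬dependsᵇ⇒flip-invariant F i j independent x =
  sym (¬T-not-≟⇒≡ (lookup (F x) j) (lookup (F (flip x i)) j) (¬T-any-allConfigs _ (subst T independent) x))

inNeighbourhood : AN n → Fin n → Subset n
inNeighbourhood {n} F j = map (λ i → dependsᵇ F i j) (allFin n)

∉inNeighbourhood⇒flip-invariant : ∀ (F : AN n) {i j} → i ∉ inNeighbourhood F j →
  ∀ x → lookup (F (flip x i)) j ≡ lookup (F x) j
∉inNeighbourhood⇒flip-invariant {n} F {i} {j} i∉ =
  ¬dependsᵇ⇒flip-invariant F i j (¬-not λ dep → i∉ (lookup⇒[]= i _ (begin
    lookup (inNeighbourhood F j) i      ≡⟨ lookup-map i _ (allFin n) ⟩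
    dependsᵇ F (lookup (allFin n) i) j  ≡⟨ cong (λ k → dependsᵇ F k j) (lookup-allFin i) ⟩
    dependsᵇ F i j                      ≡⟨ dep ⟩
    true                                ∎)))
  where open ≡-Reasoning

∣map∣≡length-filter : ∀ {A : Set} {m} (f : A → Bool) (xs : Vec A m) →
  ∣ map f xs ∣ ≡ length (filter (λ a → f a ≟ᵇ true) (toList xs))
∣map∣≡length-filter f [] = refl
∣map∣≡length-filter f (a ∷ xs) with f a
... | true = cong suc (∣map∣≡length-filter f xs)
... | false = ∣map∣≡length-filter f xs

∣inNeighbourhood∣≡inDegree : ∀ (F : AN n) j → ∣ inNeighbourhood F j ∣ ≡ inDegree F j
∣inNeighbourhood∣≡inDegree {n} F j = ∣map∣≡length-filter (λ i → dependsᵇ F i j) (allFin n)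

∣inNeighbourhood∣≤degree : ∀ (F : AN n) {d} → DegreeAtMost F d → ∀ j → ∣ inNeighbourhood F j ∣ ≤ d
∣inNeighbourhood∣≤degree F {d} degree j = subst (_≤ d) (sym (∣inNeighbourhood∣≡inDegree F j)) (degree j)

local-function-respects-≈ : ∀ (F : AN n) j x y → x ≈[ inNeighbourhood F j ] y → lookup (F x) j ≡ lookup (F y) j
local-function-respects-≈ F j x y =
  flip-invariant⇒respects-≈ (λ z → lookup (F z) j) (λ z i∉ → ∉inNeighbourhood⇒flip-invariant F i∉ z)

changesAt : AN n → Fin n → Config n → Bool
changesAt F j x = lookup x j xor lookup (F x) j

∑-count-changesAt : ∀ {F : AN n} → (∀ x → ∃ λ i → F x ≡ flip x i) →
  ∑[ j < n ] count (changesAt F j) ≡ 2 ^ n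
∑-count-changesAt {n} {F} unit-steps = begin
  ∑[ j < n ] count (changesAt F j)     ≡⟨ sumConfigs-∑-comm (λ j → 𝟙 ∘ changesAt F j) ⟨
  sumConfigs (λ x → hamming x (F x))   ≡⟨ sumConfigs-cong one-step ⟩
  sumConfigs {n} (λ _ → 1)             ≡⟨ sumConfigs-const n 1 ⟩
  2 ^ n * 1                            ≡⟨ *-identityʳ (2 ^ n) ⟩
  2 ^ n                                ∎
  where
  open ≡-Reasoning
  one-step : ∀ x → hamming x (F x) ≡ 1
  one-step x = let i , Fx≡flip = unit-steps x in trans (cong (hamming x) Fx≡flip) (hamming-flip x i)

changesAt-somewhere : ∀ {F : AN n} → IsGrayCode F → ∀ j → ∃ λ x → T (changesAt F j x)
changesAt-somewhere {n} {F} (reachable , _) j with finite-search (changesAt F j)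
... | inj₁ witness = witness
... | inj₂ never = contradiction (begin
    lookup c j                      ≡⟨ iter-preserves F (λ z → lookup z j) keeps-j k c ⟨
    lookup (iter F k c) j           ≡⟨ cong (λ z → lookup z j) iter≡flip ⟩
    lookup (flip c j) j             ≡⟨ lookup∘updateAt j c ⟩
    not (lookup c j)                ∎) (not-¬ refl)
  where
  open ≡-Reasoning
  c = replicate n false
  keeps-j : ∀ x → lookup (F x) j ≡ lookup x j
  keeps-j x = sym (¬T-xor⇒≡ _ _ (never x))
  k = proj₁ (reachable c (flip c j))
  iter≡flip = proj₂ (reachable c (flip c j))

∈-self⇒changesAt-respects-≈ : ∀ (F : AN n) {j} → j ∈ inNeighbourhood F j →
  ∀ x y → x ≈[ inNeighbourhood F j ] y → changesAt F j x ≡ changesAt F j y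
∈-self⇒changesAt-respects-≈ F {j} j∈ x y x≈y = cong₂ _xor_ (x≈y j∈) (local-function-respects-≈ F j x y x≈y)

∉-self⇒changesAt-flip : ∀ (F : AN n) {j} → j ∉ inNeighbourhood F j →
  ∀ x → changesAt F j (flip x j) ≡ not (changesAt F j x)
∉-self⇒changesAt-flip F {j} j∉ x = begin
  lookup (flip x j) j xor lookup (F (flip x j)) j  ≡⟨ cong₂ _xor_ (lookup∘updateAt j x)
                                                                  (∉inNeighbourhood⇒flip-invariant F j∉ x) ⟩
  not (lookup x j) xor lookup (F x) j             ≡⟨ not-distribˡ-xor (lookup x j) (lookup (F x) j) ⟨
  not (changesAt F j x)                           ∎
  where open ≡-Reasoning

count-changesAt-≥ : ∀ {F : AN n} {d} → IsGrayCode F → DegreeAtMost F (suc d) → ∀ j →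
  2 ^ n ≤ 2 ^ suc d * count (changesAt F j)
count-changesAt-≥ {n} {F} {d} gray degree j with j ∈? inNeighbourhood F j
... | yes j∈ = begin
  2 ^ n                                                ≤⟨ respects-≈⇒count-≥ (changesAt F j) (∈-self⇒changesAt-respects-≈ F j∈)
                                                                                (changesAt-somewhere gray j) ⟩
  2 ^ ∣ inNeighbourhood F j ∣ * count (changesAt F j)  ≤⟨ *-monoˡ-≤ _ (^-monoʳ-≤ 2 (∣inNeighbourhood∣≤degree F degree j)) ⟩
  2 ^ suc d * count (changesAt F j)                    ∎
  where open ≤-Reasoning
... | no j∉ = begin
  2 ^ n                               ≡⟨ flip-negates⇒count-half (changesAt F j) j (∉-self⇒changesAt-flip F j∉) ⟨
  2 * count (changesAt F j)           ≤⟨ *-monoˡ-≤ _ (*-monoʳ-≤ 2 (m^n>0 2 d)) ⟩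
  2 ^ suc d * count (changesAt F j)   ∎
  where open ≤-Reasoning

unit-steps⇒¬degree0 : ∀ {F : AN n} → (∀ x → ∃ λ i → F x ≡ flip x i) → ¬ DegreeAtMost F 0
unit-steps⇒¬degree0 {n} {F} unit-steps degree0 = not-¬ Fy₀≡y₀ (begin
  lookup (F y₀) k       ≡⟨ cong (λ z → lookup z k) (proj₂ (unit-steps y₀)) ⟩
  lookup (flip y₀ k) k  ≡⟨ lookup∘updateAt k y₀ ⟩
  not (lookup y₀ k)     ∎)
  where
  open ≡-Reasoning
  y₀ = F (replicate n false)
  k = proj₁ (unit-steps y₀)
  Fy₀≡y₀ : lookup (F y₀) k ≡ lookup y₀ k
  Fy₀≡y₀ = local-function-respects-≈ F k y₀ (replicate n false)
    (∣p∣≤0⇒≈ (∣inNeighbourhood∣≤degree F degree0 k) y₀ (replicate n false))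

theorem6 : (n d : ℕ) → .{{_ : NonZero n}} →
    (∃ λ (F : AN n) → IsGrayCode F × DegreeAtMost F d) → n ≤ 2 ^ d
theorem6 n zero (F , gray , degree) = contradiction degree (unit-steps⇒¬degree0 (proj₂ gray))
theorem6 n (suc d) (F , gray , degree) = *-cancelʳ-≤ n (2 ^ suc d) (2 ^ n) {{m^n≢0 2 n}} (begin
  n * 2 ^ n                                        ≡⟨ ∑-const n (2 ^ n) ⟨
  ∑[ j < n ] (2 ^ n)                               ≤⟨ ∑-mono-≤ (count-changesAt-≥ gray degree) ⟩
  ∑[ j < n ] (2 ^ suc d * count (changesAt F j))   ≡⟨ *-distribˡ-sum (2 ^ suc d) (count ∘ changesAt F) ⟨
  2 ^ suc d * ∑[ j < n ] count (changesAt F j)     ≡⟨ cong (2 ^ suc d *_) (∑-count-changesAt (proj₂ gray)) ⟩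
  2 ^ suc d * 2 ^ n                                ∎)
  where open ≤-Reasoning
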